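{- Let $H=(\mathcal{V},\mathcal{E})$ be an interval hypergraph and let $\mathcal{P}=\{\mathcal{E}_1,\dots,\mathcal{E}_k\}$ be a partition of $\mathcal{E}$ such that each $H_i=(\mathcal{V},\mathcal{E}_i)$ has an exact hitting set $h_i$. Define $t:\mathcal{E}\to\mathcal{V}$ by letting $t(I)$, for $I\in\mathcal{E}_i$, be the unique vertex of $I\cap h_i$, and let $\Gamma_t$ be the corresponding co-occurrence graph. If $\{u_1,\dots,u_q\}$ is a clique of size $q$ in $\Gamma_t$, then there are $q$ distinct parts $s_1,\dots,s_q\in\mathcal{P}$ containing intervals $I_1,\dots,I_q$ respectively, such that for each $i$, $u_i=t(I_i)$, and for each edge $(u_i,u_j)$ of the clique, $u_j\in I_i$ or $u_i\in I_j$.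
   Context: An interval hypergraph has vertex set $[n]=\{1,\dots,n\}$ and hyperedges that are intervals $\{i,\dots,j\}\subseteq[n]$. An exact hitting set of $(\mathcal{V},\mathcal{F})$ is $T\subseteq\mathcal{V}$ with $|T\cap e|=1$ for all $e\in\mathcal{F}$. For $t:\mathcal{E}\to\mathcal{V}$ with $t(e)\in e$ and image $R$, the co-occurrence graph $\Gamma_t$ has vertex set $R$, with distinct $u,v$ adjacent iff some $e\in\mathcal{E}$ satisfies $u,v\in e$ and $t(e)\in\{u,v\}$. -}

module Defs where

open import Data.Nat using (ℕ; _≤_)
open import Data.Fin using (Fin)
open import Data.Product using (_×_; Σ; ∃; ∃!; proj₁; proj₂)
open import Data.Sum using (_⊎_)
open import Relation.Binary.PropositionalEquality using (_≡_; _≢_)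
open import Function.Definitions using (Injective)

-- An interval {a,...,b} is encoded by the pair (a , b).
Interval : Set
Interval = ℕ × ℕ

_∈I_ : ℕ → Interval → Set
v ∈I I = proj₁ I ≤ v × v ≤ proj₂ I

ValidInterval : ℕ → Interval → Set
ValidInterval n I = 1 ≤ proj₁ I × proj₁ I ≤ proj₂ I × proj₂ I ≤ n

-- An interval hypergraph on [n] with m hyperedges: an injective
-- enumeration E : Fin m → Interval of a set of intervals of [n].
IsIntervalHypergraph : (n m : ℕ) → (Fin m → Interval) → Set
IsIntervalHypergraph n m E =
  (∀ e → ValidInterval n (E e)) × Injective _≡_ _≡_ E

SubsetOfV : ℕ → (ℕ → Set) → Set
SubsetOfV n T = ∀ v → T v → 1 ≤ v × v ≤ n

IsExactHittingSet : (n m : ℕ) → (Fin m → Interval) → (Fin m → Set) → (ℕ → Set) → Set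
IsExactHittingSet n m E F T =
  SubsetOfV n T × (∀ e → F e → ∃! _≡_ (λ v → v ∈I E e × T v))

-- Adjacency in the co-occurrence graph Γ_t (vertex set = image of t).
InImage : {m : ℕ} → (Fin m → ℕ) → ℕ → Set
InImage t u = ∃ λ e → t e ≡ u

Adjacent : {m : ℕ} → (Fin m → Interval) → (Fin m → ℕ) → ℕ → ℕ → Set
Adjacent E t u v =
  InImage t u × InImage t v × u ≢ v ×
  ∃ (λ e → u ∈I E e × v ∈I E e × (t e ≡ u ⊎ t e ≡ v))

IsClique : {m : ℕ} → (Fin m → Interval) → (Fin m → ℕ) → (q : ℕ) → (Fin q → ℕ) → Set
IsClique E t q u =
  Injective _≡_ _≡_ u × (∀ i → InImage t (u i)) ×
  (∀ i j → i ≢ j → Adjacent E t (u i) (u j))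

module Submission where

-- Write Covers x v when some hyperedge labelled x (t e ≡ x)
-- contains v; adjacency in Γ_t means one endpoint covers the other.  Among the
-- hyperedges labelled x, one with least left endpoint (the leftmost) contains
-- every vertex left of x that x covers, and symmetrically on the right.  Call
-- a clique vertex u_a blocked if some smaller clique vertex does not cover it;
-- represent u_a by its leftmost hyperedge if blocked, else by its rightmost.
-- By convexity, for u_a < u_b either u_a is unblocked and covers u_b, or u_b
-- is blocked and covers u_a, so one representative reaches the other label.
-- The parts of the representatives are then distinct: a shared part would
-- give a hyperedge of that part containing two vertices u_a ≠ u_b of its exact
-- hitting set.

open import Defs
open import Data.Nat using (ℕ; _≤_; _<_; _≤?_; _<?_; _≟_)
open import Data.Nat.Properties
  using (≤-trans; <⇒≤; <⇒≢; <-trans; <-cmp; ≤-totalOrder)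
open import Data.Fin using (Fin)
open import Data.Fin.Properties using (any?)
open import Data.List using (List; filter; allFin)
open import Data.List.Relation.Unary.All using (lookup)
open import Data.List.Relation.Unary.All.Properties using (all-filter)
open import Data.List.Membership.Propositional.Properties using (∈-filter⁺; ∈-allFin)
open import Data.List.Extrema ≤-totalOrder
  using (argmin; argmax; argmin-all; argmax-all; f[argmin]≤f[⊤]; f[argmin]≤f[xs];
         f[xs]≤f[argmax])
open import Data.Product using (_×_; Σ; ∃; _,_; proj₁; proj₂)
open import Data.Sum using (_⊎_; inj₁; inj₂; swap)
open import Data.Empty using (⊥-elim)
open import Relation.Nullary using (¬_; Dec; yes; no)
open import Relation.Nullary.Decidable using (_×-dec_; ¬?)
open import Relation.Unary using (Pred; Decidable)
open import Relation.Binary using (tri<; tri≈; tri>)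
open import Relation.Binary.PropositionalEquality
  using (_≡_; _≢_; refl; sym; trans; subst; cong)
open import Level using (0ℓ)
open import Function using (_∘_)
open import Function.Definitions using (Injective)

_∈I?_ : ∀ v I → Dec (v ∈I I)
v ∈I? I = (proj₁ I ≤? v) ×-dec (v ≤? proj₂ I)

∈I-convex : ∀ {x y z} I → x ∈I I → z ∈I I → x ≤ y → y ≤ z → y ∈I I
∈I-convex I (a≤x , _) (_ , z≤b) x≤y y≤z = ≤-trans a≤x x≤y , ≤-trans y≤z z≤b

module Extremes {m : ℕ} {P : Pred (Fin m) 0ℓ} (P? : Decidable P) (f : Fin m → ℕ) where

  private
    members : List (Fin m)
    members = filter P? (allFin m)

  minimiser : ∀ {e₀} → P e₀ → ∃ λ e → P e × (∀ {e'} → P e' → f e ≤ f e')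
  minimiser {e₀} Pe₀ =
    argmin f e₀ members ,
    argmin-all f Pe₀ (all-filter P? (allFin m)) ,
    λ Pe' → lookup (f[argmin]≤f[xs] e₀ members) (∈-filter⁺ P? (∈-allFin _) Pe')

  maximiser : ∀ {e₀} → P e₀ → ∃ λ e → P e × (∀ {e'} → P e' → f e' ≤ f e)
  maximiser {e₀} Pe₀ =
    argmax f e₀ members ,
    argmax-all f Pe₀ (all-filter P? (allFin m)) ,
    λ Pe' → lookup (f[xs]≤f[argmax] e₀ members) (∈-filter⁺ P? (∈-allFin _) Pe')

hitting-unique : ∀ {n m E F T e v w} → IsExactHittingSet n m E F T → F e →
                 v ∈I E e → T v → w ∈I E e → T w → v ≡ w
hitting-unique (_ , exact) Fe v∈e Tv w∈e Tw with exact _ Fe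
... | _ , _ , unique = trans (sym (unique (v∈e , Tv))) (unique (w∈e , Tw))

module LabelledIntervals {m : ℕ} (E : Fin m → Interval) (t : Fin m → ℕ)
                         (t∈E : ∀ e → t e ∈I E e) where

  Covers : ℕ → ℕ → Set
  Covers x v = ∃ λ e → t e ≡ x × v ∈I E e

  Covers? : ∀ x v → Dec (Covers x v)
  Covers? x v = any? λ e → (t e ≟ x) ×-dec (v ∈I? E e)

  label∈ : ∀ {e x} → t e ≡ x → x ∈I E e
  label∈ {e} refl = t∈E e

  covers-rightwards : ∀ {x v w} → Covers x v → x ≤ w → w ≤ v → Covers x w
  covers-rightwards (e , te≡x , v∈e) x≤w w≤v =
    e , te≡x , ∈I-convex (E e) (label∈ te≡x) v∈e x≤w w≤v

  covers-leftwards : ∀ {x v w} → Covers x v → v ≤ w → w ≤ x → Covers x w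
  covers-leftwards (e , te≡x , v∈e) v≤w w≤x =
    e , te≡x , ∈I-convex (E e) v∈e (label∈ te≡x) v≤w w≤x

  Leftmost : ℕ → Fin m → Set
  Leftmost x e = t e ≡ x × (∀ {v} → Covers x v → v ≤ x → v ∈I E e)

  Rightmost : ℕ → Fin m → Set
  Rightmost x e = t e ≡ x × (∀ {v} → Covers x v → x ≤ v → v ∈I E e)

  -- They exist for every label in use: take the hyperedge labelled x with the
  -- smallest left (largest right) endpoint.
  leftmost : ∀ {x} → InImage t x → ∃ (Leftmost x)
  leftmost {x} (e₀ , te₀≡x) with Extremes.minimiser (λ e → t e ≟ x) (proj₁ ∘ E) te₀≡x
  ... | e , te≡x , least =
    e , te≡x , λ { (e' , te'≡x , v∈e') v≤x →
      ≤-trans (least te'≡x) (proj₁ v∈e') , ≤-trans v≤x (proj₂ (label∈ te≡x)) }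

  rightmost : ∀ {x} → InImage t x → ∃ (Rightmost x)
  rightmost {x} (e₀ , te₀≡x) with Extremes.maximiser (λ e → t e ≟ x) (proj₂ ∘ E) te₀≡x
  ... | e , te≡x , greatest =
    e , te≡x , λ { (e' , te'≡x , v∈e') x≤v →
      ≤-trans (proj₁ (label∈ te≡x)) x≤v , ≤-trans (proj₂ v∈e') (greatest te'≡x) }

  adjacent⇒linked : ∀ {x y} → Adjacent E t x y → Covers x y ⊎ Covers y x
  adjacent⇒linked (_ , _ , _ , e , _ , y∈e , inj₁ te≡x) = inj₁ (e , te≡x , y∈e)
  adjacent⇒linked (_ , _ , _ , e , x∈e , _ , inj₂ te≡y) = inj₂ (e , te≡y , x∈e)

  module Representatives {q : ℕ} (u : Fin q → ℕ) (labelled : ∀ a → InImage t (u a))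
      (linked : ∀ a b → a ≢ b → Covers (u a) (u b) ⊎ Covers (u b) (u a)) where

    Blocked : Fin q → Set
    Blocked a = ∃ λ c → u c < u a × ¬ Covers (u c) (u a)

    Blocked? : ∀ a → Dec (Blocked a)
    Blocked? a = any? λ c → (u c <? u a) ×-dec ¬? (Covers? (u c) (u a))

    -- If u_a is
    -- blocked by u_c, then u_c cannot reach u_b either, and the link between
    -- u_c and u_b is a hyperedge labelled u_b reaching over u_a.
    orientation : ∀ {a b} → u a < u b →
                  (¬ Blocked a × Covers (u a) (u b)) ⊎ (Blocked b × Covers (u b) (u a))
    orientation {a} {b} a<b with Blocked? a
    ... | yes (c , c<a , c↛a) = inj₂ ((c , c<b , c↛b) , b→a)
      where
      c<b : u c < u b
      c<b = <-trans c<a a<b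
      c↛b : ¬ Covers (u c) (u b)
      c↛b c→b = c↛a (covers-rightwards c→b (<⇒≤ c<a) (<⇒≤ a<b))
      b→a : Covers (u b) (u a)
      b→a with linked c b (<⇒≢ c<b ∘ cong u)
      ... | inj₁ c→b = ⊥-elim (c↛b c→b)
      ... | inj₂ b→c = covers-leftwards b→c (<⇒≤ c<a) (<⇒≤ a<b)
    ... | no unblocked with Covers? (u a) (u b)
    ...   | yes a→b = inj₁ (unblocked , a→b)
    ...   | no a↛b with linked a b (<⇒≢ a<b ∘ cong u)
    ...     | inj₁ a→b = ⊥-elim (a↛b a→b)
    ...     | inj₂ b→a = inj₂ ((a , a<b , a↛b) , b→a)

    representative : ∀ a → Dec (Blocked a) → Fin m
    representative a (yes _) = proj₁ (leftmost (labelled a))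
    representative a (no _)  = proj₁ (rightmost (labelled a))

    rep : Fin q → Fin m
    rep a = representative a (Blocked? a)

    rep-label : ∀ a → t (rep a) ≡ u a
    rep-label a with Blocked? a
    ... | yes _ = proj₁ (proj₂ (leftmost (labelled a)))
    ... | no _  = proj₁ (proj₂ (rightmost (labelled a)))

    rep-leftmost : ∀ {a} → Blocked a → Leftmost (u a) (rep a)
    rep-leftmost {a} blocked with Blocked? a
    ... | yes _         = proj₂ (leftmost (labelled a))
    ... | no unblocked  = ⊥-elim (unblocked blocked)

    rep-rightmost : ∀ {a} → ¬ Blocked a → Rightmost (u a) (rep a)
    rep-rightmost {a} unblocked with Blocked? a
    ... | yes blocked = ⊥-elim (unblocked blocked)
    ... | no _        = proj₂ (rightmost (labelled a))

    rep-reaches-< : ∀ {a b} → u a < u b → u b ∈I E (rep a) ⊎ u a ∈I E (rep b)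
    rep-reaches-< a<b with orientation a<b
    ... | inj₁ (unblocked , a→b) = inj₁ (proj₂ (rep-rightmost unblocked) a→b (<⇒≤ a<b))
    ... | inj₂ (blocked , b→a)   = inj₂ (proj₂ (rep-leftmost blocked) b→a (<⇒≤ a<b))

    rep-reaches : ∀ a b → u b ∈I E (rep a) ⊎ u a ∈I E (rep b)
    rep-reaches a b with <-cmp (u a) (u b)
    ... | tri< a<b _ _   = rep-reaches-< a<b
    ... | tri≈ _ ua≡ub _ = inj₁ (subst (_∈I E (rep a)) ua≡ub (label∈ (rep-label a)))
    ... | tri> _ _ b<a   = swap (rep-reaches-< b<a)

lemma12 : (n m k : ℕ) (E : Fin m → Interval) → IsIntervalHypergraph n m E →
          (part : Fin k → Fin m → Set) →
          (∀ e → ∃ λ i → part i e × (∀ j → part j e → j ≡ i)) →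
          (∀ i → ∃ λ e → part i e) →
          (h : Fin k → ℕ → Set) →
          (∀ i → IsExactHittingSet n m E (part i) (h i)) →
          (t : Fin m → ℕ) →
          (∀ i e → part i e → t e ∈I E e × h i (t e)) →
          (q : ℕ) (u : Fin q → ℕ) → IsClique E t q u →
          Σ (Fin q → Fin k) λ s → Σ (Fin q → Fin m) λ I →
            Injective _≡_ _≡_ s × (∀ a → part (s a) (I a)) ×
            (∀ a → u a ≡ t (I a)) ×
            (∀ a b → a ≢ b → u b ∈I E (I a) ⊎ u a ∈I E (I b))
lemma12 n m k E _ part partition _ h hitting t t-hits q u (u-inj , labelled , adjacent) =
  s , rep , s-inj , s-part , (λ a → sym (rep-label a)) , (λ a b _ → rep-reaches a b)
  where
  t∈E : ∀ e → t e ∈I E e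
  t∈E e = proj₁ (t-hits _ e (proj₁ (proj₂ (partition e))))

  open LabelledIntervals E t t∈E
  open Representatives u labelled (λ a b a≢b → adjacent⇒linked (adjacent a b a≢b))

  s : Fin q → Fin k
  s a = proj₁ (partition (rep a))

  s-part : ∀ a → part (s a) (rep a)
  s-part a = proj₁ (proj₂ (partition (rep a)))

  u∈h : ∀ {i} a → s a ≡ i → h i (u a)
  u∈h a refl = subst (h (s a)) (rep-label a) (proj₂ (t-hits _ _ (s-part a)))

  -- Equal parts would put u_a and u_b into one hyperedge of that part, and
  -- both into its exact hitting set.
  s-inj : Injective _≡_ _≡_ s
  s-inj {a} {b} sa≡sb with rep-reaches a b
  ... | inj₁ b∈Ia = u-inj (hitting-unique (hitting (s a)) (s-part a)
                      (label∈ (rep-label a)) (u∈h a refl) b∈Ia (u∈h b (sym sa≡sb)))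
  ... | inj₂ a∈Ib = u-inj (hitting-unique (hitting (s b)) (s-part b)
                      a∈Ib (u∈h a sa≡sb) (label∈ (rep-label b)) (u∈h b refl))
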